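{- Let $\mathcal{G}=(G,\lambda)$ be a simple temporal clique with $G=(V,E)$, and let $u,v,w\in V$ with $v\neq u$, $w\neq u$, such that $\{u,v\}=e^-(v)$ and $\{u,w\}=e^+(w)$. Let $S'$ be a temporal spanner of the simple temporal clique $\mathcal{G}[V\setminus\{u\}]$ (the complete graph on $V\setminus\{u\}$ with the labels inherited from $\lambda$). Then $S=S'\cup\{\{u,v\},\{u,w\}\}$ is a temporal spanner of $\mathcal{G}$.
   Context: A simple temporal clique is a pair $\mathcal{G}=(G,\lambda)$ where $G=(V,E)$ is the complete graph on a finite vertex set $V$ and $\lambda:E\to\mathbb{N}$ assigns to each edge a single label such that any two distinct edges sharing an endpoint have distinct labels. A journey from $x$ to $y$ is a sequence of edges $\{u_1,u_2\},\dots,\{u_k,u_{k+1}\}$ with $k\ge1$, $u_1=x$, $u_{k+1}=y$, the $u_i$ pairwise distinct, and strictly increasing labels along the sequence. A subset $E'\subseteq E$ is a temporal spanner of $\mathcal{G}$ if for every ordered pair of distinct vertices $x,y$ there is a journey from $x$ to $y$ all of whose edges lie in $E'$ (when $|V|=1$ the empty set is a temporal spanner). For a vertex $v$, $e^-(v)$ (resp. $e^+(v)$) denotes the edge incident to $v$ with the smallest (resp. largest) label. -}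

module Defs where

open import Data.Nat using (ℕ; _<_)
open import Data.List using (List; []; _∷_)
open import Data.List.Relation.Unary.Unique.Propositional using (Unique)
open import Data.Product using (Σ; ∃; _×_; _,_; proj₁)
open import Data.Sum using (_⊎_)
open import Relation.Binary.PropositionalEquality using (_≡_; _≢_; refl)

-- A simple temporal clique on vertex type V: the complete graph on V with one
-- label per (unordered) edge; lab x y is the label of edge {x,y} (for x ≢ y;
-- the value of lab x x is irrelevant).
record SimpleTemporalClique (V : Set) : Set where
  field
    lab    : V → V → ℕ
    lab-sym : ∀ x y → lab x y ≡ lab y x
    proper : ∀ x y z → x ≢ y → x ≢ z → y ≢ z → lab x y ≢ lab x z
open SimpleTemporalClique public

-- A set of edges, given as a relation; the unordered edge {x,y} belongs to S
-- iff S x y or S y x.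
EdgeSet : Set → Set₁
EdgeSet V = V → V → Set

_∋ₑ_—_ : {V : Set} → EdgeSet V → V → V → Set
S ∋ₑ x — y = S x y ⊎ S y x

data Chain {V : Set} (G : SimpleTemporalClique V) (S : EdgeSet V)
     : V → V → ℕ → List V → Set where
  one  : ∀ {x y} → S ∋ₑ x — y → Chain G S x y (lab G x y) (x ∷ y ∷ [])
  cons : ∀ {x z y ℓ vs} → S ∋ₑ x — z → lab G x z < ℓ →
         Chain G S z y ℓ vs → Chain G S x y (lab G x z) (x ∷ vs)

Journey : {V : Set} → SimpleTemporalClique V → EdgeSet V → V → V → Set
Journey {V} G S x y = Σ ℕ λ ℓ → Σ (List V) λ vs → Chain G S x y ℓ vs × Unique vs

IsTemporalSpanner : {V : Set} → SimpleTemporalClique V → EdgeSet V → Set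
IsTemporalSpanner {V} G S = ∀ (x y : V) → x ≢ y → Journey G S x y

IsMinEdgeAt : {V : Set} → SimpleTemporalClique V → V → V → Set
IsMinEdgeAt {V} G v u = u ≢ v × (∀ (z : V) → z ≢ v → z ≢ u → lab G v u < lab G v z)

IsMaxEdgeAt : {V : Set} → SimpleTemporalClique V → V → V → Set
IsMaxEdgeAt {V} G w u = u ≢ w × (∀ (z : V) → z ≢ w → z ≢ u → lab G w z < lab G w u)

-- Vertex set V ∖ {u} (the proof of x ≢ u is irrelevant, so elements are
-- determined by their underlying vertex).
record Minus (V : Set) (u : V) : Set where
  constructor _,_
  field
    val : V
    .val≢u : val ≢ u
open Minus public

val-inj : {V : Set} {u : V} {p q : Minus V u} → val p ≡ val q → p ≡ q
val-inj {p = x , _} {q = .x , _} refl = refl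

delete : {V : Set} → SimpleTemporalClique V → (u : V) → SimpleTemporalClique (Minus V u)
delete G u = record
  { lab = λ a b → lab G (val a) (val b)
  ; lab-sym = λ a b → lab-sym G (val a) (val b)
  ; proper = λ a b c a≢b a≢c b≢c → proper G (val a) (val b) (val c)
               (λ e → a≢b (val-inj e)) (λ e → a≢c (val-inj e)) (λ e → b≢c (val-inj e))
  }

extend : {V : Set} (u : V) → EdgeSet (Minus V u) → V → V → EdgeSet V
extend {V} u S' v w x y =
  (Σ (Minus V u) λ a → Σ (Minus V u) λ b → val a ≡ x × val b ≡ y × S' a b)
  ⊎ (x ≡ u × y ≡ v) ⊎ (x ≡ u × y ≡ w)

module Submission where

open import Defs
open import Data.Nat using (ℕ; _<_)
open import Data.Fin using (Fin; _≟_)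
open import Data.List using (List; []; _∷_; map; _∷ʳ_)
open import Data.List.Relation.Unary.All using (All; []; _∷_; universal)
import Data.List.Relation.Unary.All.Properties as All
open import Data.List.Relation.Unary.AllPairs using ([]; _∷_)
open import Data.List.Relation.Unary.Unique.Propositional using (Unique)
import Data.List.Relation.Unary.Unique.Propositional.Properties as Unique
open import Data.Product using (_,_; proj₁)
open import Data.Sum using (inj₁; inj₂)
open import Data.Empty using (⊥-elim; ⊥-elim-irr)
open import Function using (_∘_)
open import Relation.Nullary using (yes; no)
open import Relation.Binary.Definitions using (DecidableEquality)
open import Relation.Binary.PropositionalEquality using (_≢_; refl; cong; sym; subst)

-- A journey of G[V ∖ {u}] is a journey of G avoiding u.  It can be preceded by
-- e⁻(v) when it starts at v, since every other edge at v is later, and followed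
-- by e⁺(w) when it ends at w, since every other edge at w is earlier.  So the two
-- extra edges provide all journeys from and to u.

Unique-∷ʳ⁺ : {A : Set} {xs : List A} {z : A} → Unique xs → All (z ≢_) xs → Unique (xs ∷ʳ z)
Unique-∷ʳ⁺ []         []         = [] ∷ []
Unique-∷ʳ⁺ (x∉ ∷ uxs) (z≢x ∷ ne) = All.∷ʳ⁺ x∉ (z≢x ∘ sym) ∷ Unique-∷ʳ⁺ uxs ne

Journey-edge : {V : Set} {G : SimpleTemporalClique V} {S : EdgeSet V} {x y : V} →
               S ∋ₑ x — y → x ≢ y → Journey G S x y
Journey-edge e x≢y = _ , _ , one e , (x≢y ∷ []) ∷ [] ∷ []

module _ {V : Set} {u : V} where

  val≢deleted : (a : Minus V u) → val a ≢ u
  val≢deleted (_ , a≢u) a≡u = ⊥-elim-irr (a≢u a≡u)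

  u∉map-val : (as : List (Minus V u)) → All (u ≢_) (map val as)
  u∉map-val as = All.map⁺ (universal (λ a → val≢deleted a ∘ sym) as)

  Unique-map-val : {as : List (Minus V u)} → Unique as → Unique (map val as)
  Unique-map-val = Unique.map⁺ val-inj

module _ {V : Set} (G : SimpleTemporalClique V) {u : V}
         {S' : EdgeSet (Minus V u)} {S : EdgeSet V}
         (S'⊆S : ∀ {a b} → S' ∋ₑ a — b → S ∋ₑ val a — val b) where

  private
    D = delete G u

  minEdge-<-lab : ∀ {a z} → IsMinEdgeAt G (val a) u → a ≢ z → lab G u (val a) < lab G (val a) (val z)
  minEdge-<-lab {a} {z} (_ , min) a≢z =
    subst (_< lab G (val a) (val z)) (lab-sym G (val a) u) (min (val z) (a≢z ∘ val-inj ∘ sym) (val≢deleted z))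

  lab-<-maxEdge : ∀ {a b} → IsMaxEdgeAt G (val b) u → a ≢ b → lab G (val a) (val b) < lab G (val b) u
  lab-<-maxEdge {a} {b} (_ , max) a≢b =
    subst (_< lab G (val b) u) (lab-sym G (val b) (val a)) (max (val a) (a≢b ∘ val-inj) (val≢deleted a))

  minEdge-<-chain : ∀ {a b ℓ as} → IsMinEdgeAt G (val a) u → Chain D S' a b ℓ as → Unique as →
                    lab G u (val a) < ℓ
  minEdge-<-chain min (one _)                 ((a≢b ∷ []) ∷ _) = minEdge-<-lab min a≢b
  minEdge-<-chain min (cons _ _ (one _))      ((a≢z ∷ _) ∷ _)  = minEdge-<-lab min a≢z
  minEdge-<-chain min (cons _ _ (cons _ _ _)) ((a≢z ∷ _) ∷ _)  = minEdge-<-lab min a≢z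

  Chain-val : ∀ {a b ℓ as} → Chain D S' a b ℓ as → Chain G S (val a) (val b) ℓ (map val as)
  Chain-val (one e)        = one (S'⊆S e)
  Chain-val (cons e lt es) = cons (S'⊆S e) lt (Chain-val es)

  Chain-val-∷ʳ-maxEdge : ∀ {a b ℓ as} → IsMaxEdgeAt G (val b) u → S ∋ₑ val b — u →
                         Chain D S' a b ℓ as → Unique as → Chain G S (val a) u ℓ (map val as ∷ʳ u)
  Chain-val-∷ʳ-maxEdge max bu (one e) ((a≢b ∷ []) ∷ _) =
    cons (S'⊆S e) (lab-<-maxEdge max a≢b) (one bu)
  Chain-val-∷ʳ-maxEdge max bu (cons e lt es) (_ ∷ uniq) =
    cons (S'⊆S e) lt (Chain-val-∷ʳ-maxEdge max bu es uniq)

  Journey-val : ∀ {a b} → Journey D S' a b → Journey G S (val a) (val b)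
  Journey-val (ℓ , as , es , uniq) = ℓ , map val as , Chain-val es , Unique-map-val uniq

  Journey-minEdge-∷-val : ∀ {a b} → IsMinEdgeAt G (val a) u → S ∋ₑ u — val a →
                          Journey D S' a b → Journey G S u (val b)
  Journey-minEdge-∷-val min ua (ℓ , as , es , uniq) =
    _ , u ∷ map val as , cons ua (minEdge-<-chain min es uniq) (Chain-val es) ,
    u∉map-val as ∷ Unique-map-val uniq

  Journey-val-∷ʳ-maxEdge : ∀ {a b} → IsMaxEdgeAt G (val b) u → S ∋ₑ val b — u →
                           Journey D S' a b → Journey G S (val a) u
  Journey-val-∷ʳ-maxEdge max bu (ℓ , as , es , uniq) =
    ℓ , map val as ∷ʳ u , Chain-val-∷ʳ-maxEdge max bu es uniq ,
    Unique-∷ʳ⁺ (Unique-map-val uniq) (u∉map-val as)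

S'⊆extend : {V : Set} {u v w : V} {S' : EdgeSet (Minus V u)} {a b : Minus V u} →
            S' ∋ₑ a — b → extend u S' v w ∋ₑ val a — val b
S'⊆extend {a = a} {b} (inj₁ s) = inj₁ (inj₁ (a , b , refl , refl , s))
S'⊆extend {a = a} {b} (inj₂ s) = inj₂ (inj₁ (b , a , refl , refl , s))

extend-isTemporalSpanner : {V : Set} → DecidableEquality V →
  (G : SimpleTemporalClique V) (u v w : V) → IsMinEdgeAt G v u → IsMaxEdgeAt G w u →
  (S' : EdgeSet (Minus V u)) → IsTemporalSpanner (delete G u) S' →
  IsTemporalSpanner G (extend u S' v w)
extend-isTemporalSpanner _≟_ G u v w min max S' span x y x≢y with x ≟ u | y ≟ u
... | yes refl | yes refl = ⊥-elim (x≢y refl)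
... | no x≢u   | no y≢u   = Journey-val G S'⊆extend (span (x , x≢u) (y , y≢u) (x≢y ∘ cong val))
... | yes refl | no y≢u with y ≟ v
...   | yes refl = Journey-edge (inj₁ (inj₂ (inj₁ (refl , refl)))) x≢y
...   | no y≢v   = Journey-minEdge-∷-val G S'⊆extend min (inj₁ (inj₂ (inj₁ (refl , refl))))
                     (span (v , proj₁ min ∘ sym) (y , y≢u) (y≢v ∘ sym ∘ cong val))
extend-isTemporalSpanner _≟_ G u v w min max S' span x y x≢y
    | no x≢u | yes refl with x ≟ w
...   | yes refl = Journey-edge (inj₂ (inj₂ (inj₂ (refl , refl)))) x≢y
...   | no x≢w   = Journey-val-∷ʳ-maxEdge G S'⊆extend max (inj₂ (inj₂ (inj₂ (refl , refl))))
                     (span (x , x≢u) (w , proj₁ max ∘ sym) (x≢w ∘ cong val))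

-- The hypotheses v ≢ u and w ≢ u are already contained in IsMinEdgeAt and IsMaxEdgeAt.
theorem1 : (n : ℕ) (G : SimpleTemporalClique (Fin n)) (u v w : Fin n) →
    v ≢ u → w ≢ u → IsMinEdgeAt G v u → IsMaxEdgeAt G w u →
    (S' : EdgeSet (Minus (Fin n) u)) → IsTemporalSpanner (delete G u) S' →
    IsTemporalSpanner G (extend u S' v w)
theorem1 n G u v w _ _ = extend-isTemporalSpanner _≟_ G u v w
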